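{- Let $L$ be a subspace of $\bigwedge^kV$ and let $I\subseteq[n]$. Suppose $N_{j\to i}L=L$ for all $i<j$ with $i,j\in I$. Then for each $x\in\bigwedge V^{(I)}$, the variable sets (viewed as subsets of $I$) of the monomials $y\in\bigwedge V^{([n]\setminus I)}$ such that $x\wedge y\in L$ form a set system that is shifted with respect to $I$.
   Context: Let $\mathbb{F}$ be a field (the paper assumes characteristic $\neq2$), $V$ an $n$-dimensional $\mathbb{F}$-space with fixed basis $e_1,\dots,e_n$. For $J\subseteq[n]$, $V^{(J)}$ is the span of $\{e_h:h\notin J\}$, and $\bigwedge V^{(J)}$ is regarded as a subalgebra of $\bigwedge V$; thus monomials of $\bigwedge V^{([n]\setminus I)}$ are the $e_S$ with $S\subseteq I$. Monomials are $e_S=e_{s_1}\wedge\cdots\wedge e_{s_k}$, $S=\{s_1<\cdots<s_k\}$, with variable set $\{e_s:s\in S\}$, identified with $S$; the support of a form is the set of monomials with nonzero coefficient. Combinatorial shifting: for a family $\mathcal{F}$ of subsets of $[n]$, $F\in\mathcal{F}$ and $i<j$, $\mathrm{shift}_{j\to i}(F,\mathcal{F})=(F\setminus\{j\})\cup\{i\}$ if $j\in F$, $i\notin F$ and $(F\setminus\{j\})\cup\{i\}\notin\mathcal{F}$, and $=F$ otherwise; $\mathrm{shift}_{j\to i}\mathcal{F}=\{\mathrm{shift}_{j\to i}(F,\mathcal{F}):F\in\mathcal{F}\}$. $\mathcal{F}$ is shifted with respect to $I$ if $\mathrm{shift}_{j\to i}\mathcal{F}=\mathcal{F}$ for all $i<j$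 in $I$. Slow shifting: let $t$ be transcendental over $\mathbb{F}$, $V(t)=V\otimes\mathbb{F}(t)$, and for distinct $i,j$ let $N_{j\to i}(t)$ be the linear map $e_j\mapsto e_i+te_j$, $e_h\mapsto e_h$ ($h\ne j$), extended to $\bigwedge V(t)$ multiplicatively. For nonzero $m\in\bigwedge^kV$, $N_{j\to i}m$ is obtained (up to scalar) by rescaling $N_{j\to i}(t)m$ so its coefficients are polynomials in $t$ with no common factor of positive degree and evaluating at $t=0$. Explicitly, writing $m=x+e_j\wedge y$ with no monomial in the supports of $x,y$ having $e_j$ in its variable set, $N_{j\to i}m=x+e_i\wedge y$ if this is nonzero, and $e_j\wedge y$ otherwise. For a subspace $L$, $N_{j\to i}L$ is the limit subspace (via the analogous limit of the Plücker point of a basis of $L$); it equals the span of $\{N_{j\to i}m:0\ne m\in L\}$ and has dimension $\dim L$. -}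

module Defs where

open import Level using (Level; _⊔_; suc)
open import Data.Nat using (ℕ; zero; suc)
open import Data.Bool using (Bool; true; false; if_then_else_; _∧_)
open import Data.Fin using (Fin; _<_; _<?_)
open import Data.Fin.Subset using (Subset; _∈_; _∉_; _⊆_; _─_; _∪_; _-_; ⁅_⁆; ∣_∣)
open import Data.Fin.Subset.Properties using (_∈?_; _⊆?_)
open import Data.List using (List; map; allFin)
open import Data.Nat.ListAction using (sum)
open import Data.Product using (Σ; Σ-syntax; _×_)
open import Data.Sum using (_⊎_)
open import Relation.Nullary using (¬_; does)
open import Relation.Binary.PropositionalEquality using (_≡_)
open import Algebra.Bundles using (CommutativeRing)

record Field (c ℓ : Level) : Set (Level.suc (c ⊔ ℓ)) where
  field
    commutativeRing : CommutativeRing c ℓ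
  open CommutativeRing commutativeRing public
  field
    0≉1     : ¬ (0# ≈ 1#)
    inverse : ∀ x → ¬ (x ≈ 0#) → Σ[ y ∈ Carrier ] (x * y ≈ 1#)

module Exterior {c ℓ : Level} (F : Field c ℓ) (n : ℕ) where
  open Field F

  -- An element of ⋀V (dim V = n), given by its coefficients in the
  -- monomial basis e_S, S ⊆ [n].
  Form : Set c
  Form = Subset n → Carrier

  _≈ᵥ_ : Form → Form → Set ℓ
  x ≈ᵥ y = ∀ S → x S ≈ y S

  0ᵥ : Form
  0ᵥ S = 0#

  _+ᵥ_ : Form → Form → Form
  (x +ᵥ y) S = x S + y S

  _·ᵥ_ : Carrier → Form → Form
  (a ·ᵥ x) S = a * x S

  sgn : ℕ → Carrier
  sgn zero    = 1#
  sgn (suc k) = - sgn k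

  inv : Subset n → Subset n → ℕ
  inv S T = sum (map (λ s → sum (map (λ t →
              if does (s ∈? S) ∧ does (t ∈? T) ∧ does (t <? s) then 1 else 0)
              (allFin n))) (allFin n))

  -- e_S ∧ e_T = sgn (inv S T) e_{S ∪ T}  for disjoint S, T.
  -- Right multiplication by a monomial:  x ∧ e_T
  _∧ₘ_ : Form → Subset n → Form
  (x ∧ₘ T) U = if does (T ⊆? U) then sgn (inv (U ─ T) T) * x (U ─ T) else 0#

  _ₘ∧_ : Subset n → Form → Form
  (T ₘ∧ y) U = if does (T ⊆? U) then sgn (inv T (U ─ T)) * y (U ─ T) else 0#

  -- x ∈ ⋀ V^{(J)}: every monomial in the support of x avoids J
  InWedge : Subset n → Form → Set ℓ
  InWedge J x = ∀ S h → h ∈ S → h ∈ J → x S ≈ 0#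

  record Subspace (k : ℕ) (p : Level) : Set (c ⊔ ℓ ⊔ Level.suc p) where
    field
      Mem      : Form → Set p
      resp     : ∀ {x y} → x ≈ᵥ y → Mem x → Mem y
      zero-mem : Mem 0ᵥ
      add-mem  : ∀ {x y} → Mem x → Mem y → Mem (x +ᵥ y)
      scal-mem : ∀ a {x} → Mem x → Mem (a ·ᵥ x)
      homog    : ∀ {x} → Mem x → ∀ S → ¬ (∣ S ∣ ≡ k) → x S ≈ 0#

  data Span {q : Level} (Q : Form → Set q) : Form → Set (c ⊔ ℓ ⊔ q) where
    gen   : ∀ {v} → Q v → Span Q v
    zer   : ∀ {v} → v ≈ᵥ 0ᵥ → Span Q v
    add   : ∀ {a b v} → Span Q a → Span Q b → v ≈ᵥ (a +ᵥ b) → Span Q v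
    scal  : ∀ {a v} (r : Carrier) → Span Q a → v ≈ᵥ (r ·ᵥ a) → Span Q v

  -- m' is (a representative of) N_{j→i} m: writing m = x + e_j ∧ y with
  -- no monomial of x, y containing e_j, N_{j→i} m = x + e_i ∧ y if nonzero,
  -- and e_j ∧ y otherwise.
  NRel : Fin n → Fin n → Form → Form → Set (c ⊔ ℓ)
  NRel j i m m' =
    Σ[ x ∈ Form ] Σ[ y ∈ Form ]
      InWedge ⁅ j ⁆ x × InWedge ⁅ j ⁆ y × m ≈ᵥ (x +ᵥ (⁅ j ⁆ ₘ∧ y)) ×
      ((¬ ((x +ᵥ (⁅ i ⁆ ₘ∧ y)) ≈ᵥ 0ᵥ) × m' ≈ᵥ (x +ᵥ (⁅ i ⁆ ₘ∧ y)))
       ⊎ ((x +ᵥ (⁅ i ⁆ ₘ∧ y)) ≈ᵥ 0ᵥ × m' ≈ᵥ (⁅ j ⁆ ₘ∧ y)))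

  NL : ∀ {k p} → Fin n → Fin n → Subspace k p → Form → Set (c ⊔ ℓ ⊔ p)
  NL j i L = Span (λ m' → Σ[ m ∈ Form ] Subspace.Mem L m × ¬ (m ≈ᵥ 0ᵥ) × NRel j i m m')

  NFixes : ∀ {k p} → Fin n → Fin n → Subspace k p → Set (c ⊔ ℓ ⊔ p)
  NFixes j i L = ∀ v → (NL j i L v → Subspace.Mem L v) × (Subspace.Mem L v → NL j i L v)

module Shifting {n : ℕ} {q : Level} (𝓕 : Subset n → Set q) where

  ShiftRel : Fin n → Fin n → Subset n → Subset n → Set q
  ShiftRel j i F G =
    (j ∈ F × i ∉ F × ¬ 𝓕 ((F - j) ∪ ⁅ i ⁆) × G ≡ (F - j) ∪ ⁅ i ⁆)
    ⊎ (¬ (j ∈ F × i ∉ F × ¬ 𝓕 ((F - j) ∪ ⁅ i ⁆)) × G ≡ F)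

  shiftFam : Fin n → Fin n → Subset n → Set q
  shiftFam j i G = Σ[ F ∈ Subset n ] 𝓕 F × ShiftRel j i F G

  ShiftedWrt : Subset n → Set q
  ShiftedWrt I = ∀ i j → i ∈ I → j ∈ I → i < j →
    ∀ G → (shiftFam j i G → 𝓕 G) × (𝓕 G → shiftFam j i G)

{-# OPTIONS --safe #-}
module Submission where

-- Let rename j i be the algebra endomorphism of ⋀V induced by e_j ↦ e_i, i.e. N_{j→i}(t) at t = 0:
-- it sends X + e_j ∧ Y (X, Y free of e_j) to X + e_i ∧ Y. Unlike N_{j→i} it is linear, and it
-- maps every generator N_{j→i} m (0 ≠ m ∈ L) of N_{j→i} L into L: either N_{j→i} m = X + e_i ∧ Y
-- is free of e_j and hence fixed, or X + e_i ∧ Y = 0, N_{j→i} m = e_j ∧ Y, and rename sends it to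
-- e_i ∧ Y = N_{j→i} m − m. As N_{j→i} L = L, rename j i maps L into itself. For x free of e_j and
-- j ∈ T ∌ i it sends x ∧ e_T to ± x ∧ e_{(T − j) ∪ i}. Hence {T ⊆ I : x ∧ e_T ∈ L} is closed under
-- every exchange j → i with i < j in I, and such a family is left unchanged by every shift.

open import Defs
open import Level using (Level)
open import Data.Nat using (ℕ)
open import Data.Fin using (_<_)
open import Data.Fin.Subset using (Subset; _∈_; _⊆_)
open import Data.Product using (_×_)
open import Relation.Nullary using (¬_)

import Data.Nat as ℕ
open import Level using (_⊔_)
open import Data.Bool using (true; false; if_then_else_; _∧_; _∨_)
open import Data.Bool.Properties using (∧-zeroʳ)
open import Data.Nat using (zero; suc)
open import Data.Fin using (Fin; zero; suc; _<?_)
open import Data.Fin.Properties using (<-cmp; <⇒≢; suc-injective)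
open import Data.Fin.Subset using (_∉_; _─_; _∪_; _-_; ⁅_⁆; ⊥; ∣_∣; inside; outside)
open import Data.Fin.Subset.Properties
  using ( _∈?_; _⊆?_; ⊆-antisym; ⊆-trans; x∈⁅x⁆; x∈⁅y⁆⇒x≡y; x∈p∪q⁻; x∈p∪q⁺; q⊆p∪q
        ; x∈p∧x∉q⇒x∈p─q; p─q⊆p; p─⊥≡p; ∪-identityˡ )
import Data.List as List
open import Data.Nat.ListAction using (sum)
open import Data.Vec using ([]; _∷_; here; there)
open import Data.Product using (Σ-syntax; _,_; proj₁; proj₂)
open import Data.Sum using (inj₁; inj₂)
open import Function using (id; _∘_)
open import Relation.Nullary using (Dec; yes; no; does; contradiction)
open import Relation.Nullary.Decidable using (dec-true; dec-false)
open import Relation.Binary.PropositionalEquality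
  using (_≡_; _≢_; refl; sym; trans; cong; cong₂; subst; module ≡-Reasoning)

private variable n : ℕ

x∈p─q⁻ : ∀ {x : Fin n} (p q : Subset n) → x ∈ p ─ q → x ∈ p × x ∉ q
x∈p─q⁻ {x = zero}  (inside ∷ p) (outside ∷ q) here = here , λ ()
x∈p─q⁻ {x = suc x} (_ ∷ p)      (_ ∷ q)       (there x∈p─q) with x∈p─q⁻ p q x∈p─q
... | x∈p , x∉q = there x∈p , λ { (there x∈q) → x∉q x∈q }

x∉p-x : ∀ (p : Subset n) x → x ∉ p - x
x∉p-x p x x∈p-x = proj₂ (x∈p─q⁻ p ⁅ x ⁆ x∈p-x) (x∈⁅x⁆ x)

x∈p⇒⁅x⁆⊆p : ∀ {x : Fin n} {p} → x ∈ p → ⁅ x ⁆ ⊆ p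
x∈p⇒⁅x⁆⊆p {x = x} {p} x∈p y∈⁅x⁆ = subst (_∈ p) (sym (x∈⁅y⁆⇒x≡y x y∈⁅x⁆)) x∈p

∪-lub : ∀ {p q r : Subset n} → p ⊆ r → q ⊆ r → p ∪ q ⊆ r
∪-lub {p = p} {q} p⊆r q⊆r y∈p∪q with x∈p∪q⁻ p q y∈p∪q
... | inj₁ y∈p = p⊆r y∈p
... | inj₂ y∈q = q⊆r y∈q

∪-monoˡ-⊆ : ∀ {p q : Subset n} r → q ⊆ p → q ∪ r ⊆ p ∪ r
∪-monoˡ-⊆ {p = p} {q} r q⊆p y∈q∪r with x∈p∪q⁻ q r y∈q∪r
... | inj₁ y∈q = x∈p∪q⁺ (inj₁ (q⊆p y∈q))
... | inj₂ y∈r = x∈p∪q⁺ (inj₂ y∈r)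

∪⁅x⁆-cancelˡ-⊆ : ∀ {p q : Subset n} {x} → x ∉ q → q ∪ ⁅ x ⁆ ⊆ p ∪ ⁅ x ⁆ → q ⊆ p
∪⁅x⁆-cancelˡ-⊆ {p = p} {q} {x} x∉q q∪x⊆p∪x {y} y∈q
  with x∈p∪q⁻ p ⁅ x ⁆ (q∪x⊆p∪x (x∈p∪q⁺ (inj₁ y∈q)))
... | inj₁ y∈p   = y∈p
... | inj₂ y∈⁅x⁆ = contradiction (subst (_∈ q) (x∈⁅y⁆⇒x≡y x y∈⁅x⁆) y∈q) x∉q

p─q∪q≡p : ∀ {p q : Subset n} → q ⊆ p → (p ─ q) ∪ q ≡ p
p─q∪q≡p {p = p} {q} q⊆p = ⊆-antisym ⊆p p⊆
  where
  ⊆p : (p ─ q) ∪ q ⊆ p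
  ⊆p y∈ with x∈p∪q⁻ (p ─ q) q y∈
  ... | inj₁ y∈p─q = p─q⊆p p q y∈p─q
  ... | inj₂ y∈q   = q⊆p y∈q
  p⊆ : p ⊆ (p ─ q) ∪ q
  p⊆ {y} y∈p with y ∈? q
  ... | yes y∈q = x∈p∪q⁺ (inj₂ y∈q)
  ... | no  y∉q = x∈p∪q⁺ (inj₁ (x∈p∧x∉q⇒x∈p─q y∈p y∉q))

p-x∪⁅x⁆≡p : ∀ {p : Subset n} {x} → x ∈ p → (p - x) ∪ ⁅ x ⁆ ≡ p
p-x∪⁅x⁆≡p x∈p = p─q∪q≡p (x∈p⇒⁅x⁆⊆p x∈p)

p∪⁅x⁆─q∪⁅x⁆≡p─q : ∀ {p : Subset n} q {x} → x ∉ p → (p ∪ ⁅ x ⁆) ─ (q ∪ ⁅ x ⁆) ≡ p ─ q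
p∪⁅x⁆─q∪⁅x⁆≡p─q {p = p} q {x} x∉p = ⊆-antisym ⊆p─q p─q⊆
  where
  ⊆p─q : (p ∪ ⁅ x ⁆) ─ (q ∪ ⁅ x ⁆) ⊆ p ─ q
  ⊆p─q y∈ with x∈p─q⁻ (p ∪ ⁅ x ⁆) (q ∪ ⁅ x ⁆) y∈
  ... | y∈p∪x , y∉q∪x with x∈p∪q⁻ p ⁅ x ⁆ y∈p∪x
  ...   | inj₁ y∈p = x∈p∧x∉q⇒x∈p─q y∈p (y∉q∪x ∘ x∈p∪q⁺ ∘ inj₁)
  ...   | inj₂ y∈x = contradiction (x∈p∪q⁺ (inj₂ y∈x)) y∉q∪x
  p─q⊆ : p ─ q ⊆ (p ∪ ⁅ x ⁆) ─ (q ∪ ⁅ x ⁆)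
  p─q⊆ {y} y∈ with x∈p─q⁻ p q y∈
  ... | y∈p , y∉q = x∈p∧x∉q⇒x∈p─q (x∈p∪q⁺ (inj₁ y∈p)) y∉q∪x
    where
    y∉q∪x : y ∉ q ∪ ⁅ x ⁆
    y∉q∪x y∈q∪x with x∈p∪q⁻ q ⁅ x ⁆ y∈q∪x
    ... | inj₁ y∈q = y∉q y∈q
    ... | inj₂ y∈x = x∉p (subst (_∈ p) (x∈⁅y⁆⇒x≡y x y∈x) y∈p)

p∪⁅x⁆-x≡p : ∀ {p : Subset n} {x} → x ∉ p → (p ∪ ⁅ x ⁆) - x ≡ p
p∪⁅x⁆-x≡p {p = p} {x} x∉p = begin
  (p ∪ ⁅ x ⁆) ─ ⁅ x ⁆       ≡⟨ cong ((p ∪ ⁅ x ⁆) ─_) (sym (∪-identityˡ ⁅ x ⁆)) ⟩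
  (p ∪ ⁅ x ⁆) ─ (⊥ ∪ ⁅ x ⁆) ≡⟨ p∪⁅x⁆─q∪⁅x⁆≡p─q ⊥ x∉p ⟩
  p ─ ⊥                     ≡⟨ p─⊥≡p p ⟩
  p                         ∎
  where open ≡-Reasoning

does-∈?-∪ : ∀ (x : Fin n) p q → does (x ∈? p ∪ q) ≡ does (x ∈? p) ∨ does (x ∈? q)
does-∈?-∪ zero    (inside  ∷ p) (_       ∷ q) = refl
does-∈?-∪ zero    (outside ∷ p) (inside  ∷ q) = refl
does-∈?-∪ zero    (outside ∷ p) (outside ∷ q) = refl
does-∈?-∪ (suc x) (_       ∷ p) (_       ∷ q) = does-∈?-∪ x p q

module Counting where
  open import Data.Nat using (_+_)
  open import Data.Nat.Properties using (+-0-monoid; +-commutativeSemigroup; +-identityʳ)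
  open import Data.List.Properties using (map-tabulate)
  open import Relation.Binary.Definitions using (tri<; tri≈; tri>)
  open import Algebra.Properties.CommutativeSemigroup +-commutativeSemigroup using (interchange)
  open import Algebra.Properties.Monoid.Sum +-0-monoid public
    using (sum-cong-≗) renaming (sum to ∑)

  ∑-+ : ∀ {n} (f g : Fin n → ℕ) → ∑ (λ k → f k + g k) ≡ ∑ f + ∑ g
  ∑-+ {zero}  f g = refl
  ∑-+ {suc n} f g = trans (cong (f zero + g zero +_) (∑-+ (f ∘ suc) (g ∘ suc)))
                          (interchange (f zero) (g zero) _ _)

  ∑-zero : ∀ {n} (f : Fin n → ℕ) → (∀ k → f k ≡ 0) → ∑ f ≡ 0
  ∑-zero {zero}  f f≡0 = refl
  ∑-zero {suc n} f f≡0 = cong₂ _+_ (f≡0 zero) (∑-zero (f ∘ suc) (f≡0 ∘ suc))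

  ∑-single : ∀ {n} (f : Fin n → ℕ) i → (∀ k → k ≢ i → f k ≡ 0) → ∑ f ≡ f i
  ∑-single f zero    f≡0 =
    trans (cong (f zero +_) (∑-zero (f ∘ suc) (λ k → f≡0 (suc k) λ ()))) (+-identityʳ (f zero))
  ∑-single f (suc i) f≡0 =
    cong₂ _+_ (f≡0 zero λ ()) (∑-single (f ∘ suc) i (λ k k≢i → f≡0 (suc k) (k≢i ∘ suc-injective)))

  ∑-allFin : ∀ {n} (f : Fin n → ℕ) → sum (List.map f (List.allFin n)) ≡ ∑ f
  ∑-allFin f = trans (cong sum (map-tabulate id f)) (sum-tabulate f)
    where
    sum-tabulate : ∀ {n} (g : Fin n → ℕ) → sum (List.tabulate g) ≡ ∑ g
    sum-tabulate {zero}  g = refl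
    sum-tabulate {suc n} g = cong (g zero +_) (sum-tabulate (g ∘ suc))

  ∑-∈? : ∀ {n} (p : Subset n) → ∑ (λ t → if does (t ∈? p) then 1 else 0) ≡ ∣ p ∣
  ∑-∈? []            = refl
  ∑-∈? (inside ∷ p)  = cong suc (∑-∈? p)
  ∑-∈? (outside ∷ p) = ∑-∈? p

  ∧-∨-split : ∀ a b c d → b ∧ c ≡ false →
    (if a ∧ (b ∨ c) ∧ d then 1 else 0) ≡ (if a ∧ b ∧ d then 1 else 0) + (if a ∧ c ∧ d then 1 else 0)
  ∧-∨-split false b     c     d     _  = refl
  ∧-∨-split true  false c     d     _  = refl
  ∧-∨-split true  true  false false _  = refl
  ∧-∨-split true  true  false true  _  = refl
  ∧-∨-split true  true  true  d     ()

  below+above≡member : ∀ {x : Fin n} {p} → x ∉ p → ∀ t →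
    (if does (t ∈? p) ∧ does (t <? x) then 1 else 0) + (if does (t ∈? p) ∧ does (x <? t) then 1 else 0)
      ≡ (if does (t ∈? p) then 1 else 0)
  below+above≡member {x = x} {p} x∉p t with t ∈? p
  ... | no _ = refl
  ... | yes t∈p with <-cmp t x
  ...   | tri< t<x _ x≮t rewrite dec-true (t <? x) t<x | dec-false (x <? t) x≮t = refl
  ...   | tri≈ _ t≡x _   = contradiction (subst (_∈ p) t≡x t∈p) x∉p
  ...   | tri> t≮x _ x<t rewrite dec-false (t <? x) t≮x | dec-true (x <? t) x<t = refl

-- Exterior.inv does not depend on the field; F only serves to name it.
module Inversions {c ℓ : Level} (F : Field c ℓ) (n : ℕ) where
  open import Data.Nat using (_+_)
  open import Data.Nat.Properties using (+-commutativeSemigroup)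
  open import Data.Nat.Tactic.RingSolver using (solve-∀)
  open import Algebra.Properties.CommutativeSemigroup +-commutativeSemigroup using (xy∙z≈xz∙y)
  open Exterior F n using (inv)
  open Counting

  inversion : Subset n → Subset n → Fin n → Fin n → ℕ
  inversion S T s t = if does (s ∈? S) ∧ does (t ∈? T) ∧ does (t <? s) then 1 else 0

  inv≡∑∑ : ∀ S T → inv S T ≡ ∑ λ s → ∑ (inversion S T s)
  inv≡∑∑ S T = trans (∑-allFin (λ s → sum (List.map (inversion S T s) (List.allFin n))))
                     (sum-cong-≗ (λ s → ∑-allFin (inversion S T s)))

  inv-∪ʳ : ∀ p {q r} → (∀ {x} → x ∈ q → x ∉ r) → inv p (q ∪ r) ≡ inv p q + inv p r
  inv-∪ʳ p {q} {r} q∩r=∅ = begin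
    inv p (q ∪ r)
      ≡⟨ inv≡∑∑ p (q ∪ r) ⟩
    ∑ (λ s → ∑ (inversion p (q ∪ r) s))
      ≡⟨ sum-cong-≗ (λ s → sum-cong-≗ (split s)) ⟩
    ∑ (λ s → ∑ λ t → inversion p q s t + inversion p r s t)
      ≡⟨ sum-cong-≗ (λ s → ∑-+ (inversion p q s) (inversion p r s)) ⟩
    ∑ (λ s → ∑ (inversion p q s) + ∑ (inversion p r s))
      ≡⟨ ∑-+ (λ s → ∑ (inversion p q s)) (λ s → ∑ (inversion p r s)) ⟩
    ∑ (λ s → ∑ (inversion p q s)) + ∑ (λ s → ∑ (inversion p r s))
      ≡⟨ sym (cong₂ _+_ (inv≡∑∑ p q) (inv≡∑∑ p r)) ⟩
    inv p q + inv p r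
      ∎
    where
    open ≡-Reasoning
    disjoint : ∀ t → does (t ∈? q) ∧ does (t ∈? r) ≡ false
    disjoint t with t ∈? q
    ... | yes t∈q = dec-false (t ∈? r) (q∩r=∅ t∈q)
    ... | no  _   = refl
    split : ∀ s t → inversion p (q ∪ r) s t ≡ inversion p q s t + inversion p r s t
    split s t rewrite does-∈?-∪ t q r =
      ∧-∨-split (does (s ∈? p)) (does (t ∈? q)) (does (t ∈? r)) (does (t <? s)) (disjoint t)

  inv-⁅x⁆ˡ : ∀ x p → inv ⁅ x ⁆ p ≡ ∑ λ t → if does (t ∈? p) ∧ does (t <? x) then 1 else 0
  inv-⁅x⁆ˡ x p = trans (inv≡∑∑ ⁅ x ⁆ p) (trans (∑-single (λ s → ∑ (inversion ⁅ x ⁆ p s)) x off) on)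
    where
    off : ∀ s → s ≢ x → ∑ (inversion ⁅ x ⁆ p s) ≡ 0
    off s s≢x rewrite dec-false (s ∈? ⁅ x ⁆) (s≢x ∘ x∈⁅y⁆⇒x≡y x) = ∑-zero {n} (λ _ → 0) (λ _ → refl)
    on : ∑ (λ t → if does (x ∈? ⁅ x ⁆) ∧ does (t ∈? p) ∧ does (t <? x) then 1 else 0)
       ≡ ∑ (λ t → if does (t ∈? p) ∧ does (t <? x) then 1 else 0)
    on rewrite dec-true (x ∈? ⁅ x ⁆) (x∈⁅x⁆ x) = refl

  inv-⁅x⁆ʳ : ∀ x p → inv p ⁅ x ⁆ ≡ ∑ λ s → if does (s ∈? p) ∧ does (x <? s) then 1 else 0
  inv-⁅x⁆ʳ x p = trans (inv≡∑∑ p ⁅ x ⁆)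
                       (sum-cong-≗ λ s → trans (∑-single (inversion p ⁅ x ⁆ s) x (off s)) (on s))
    where
    off : ∀ s t → t ≢ x → inversion p ⁅ x ⁆ s t ≡ 0
    off s t t≢x rewrite dec-false (t ∈? ⁅ x ⁆) (t≢x ∘ x∈⁅y⁆⇒x≡y x) =
      cong (λ b → if b then 1 else 0) (∧-zeroʳ (does (s ∈? p)))
    on : ∀ s → (if does (s ∈? p) ∧ does (x ∈? ⁅ x ⁆) ∧ does (x <? s) then 1 else 0)
             ≡ (if does (s ∈? p) ∧ does (x <? s) then 1 else 0)
    on s rewrite dec-true (x ∈? ⁅ x ⁆) (x∈⁅x⁆ x) = refl

  inv-⁅x⁆-flip : ∀ {x p} → x ∉ p → inv ⁅ x ⁆ p + inv p ⁅ x ⁆ ≡ ∣ p ∣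
  inv-⁅x⁆-flip {x} {p} x∉p = begin
    inv ⁅ x ⁆ p + inv p ⁅ x ⁆                 ≡⟨ cong₂ _+_ (inv-⁅x⁆ˡ x p) (inv-⁅x⁆ʳ x p) ⟩
    ∑ below + ∑ above                         ≡⟨ sym (∑-+ below above) ⟩
    ∑ (λ t → below t + above t)               ≡⟨ sum-cong-≗ (below+above≡member x∉p) ⟩
    ∑ (λ t → if does (t ∈? p) then 1 else 0)  ≡⟨ ∑-∈? p ⟩
    ∣ p ∣                                     ∎
    where
    open ≡-Reasoning
    below above : Fin n → ℕ
    below t = if does (t ∈? p) ∧ does (t <? x) then 1 else 0
    above t = if does (t ∈? p) ∧ does (x <? t) then 1 else 0

  inv-⁅x⁆-⊆ : ∀ {x B R} → x ∉ B → R ⊆ B →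
    inv ⁅ x ⁆ B + inv (B ─ R) ⁅ x ⁆ ≡ ∣ B ─ R ∣ + inv ⁅ x ⁆ R
  inv-⁅x⁆-⊆ {x} {B} {R} x∉B R⊆B = begin
    inv ⁅ x ⁆ B + inv (B ─ R) ⁅ x ⁆
      ≡⟨ cong (λ A → inv ⁅ x ⁆ A + inv (B ─ R) ⁅ x ⁆) (sym (p─q∪q≡p R⊆B)) ⟩
    inv ⁅ x ⁆ ((B ─ R) ∪ R) + inv (B ─ R) ⁅ x ⁆
      ≡⟨ cong (_+ inv (B ─ R) ⁅ x ⁆) (inv-∪ʳ ⁅ x ⁆ (proj₂ ∘ x∈p─q⁻ B R)) ⟩
    inv ⁅ x ⁆ (B ─ R) + inv ⁅ x ⁆ R + inv (B ─ R) ⁅ x ⁆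
      ≡⟨ xy∙z≈xz∙y (inv ⁅ x ⁆ (B ─ R)) _ _ ⟩
    inv ⁅ x ⁆ (B ─ R) + inv (B ─ R) ⁅ x ⁆ + inv ⁅ x ⁆ R
      ≡⟨ cong (_+ inv ⁅ x ⁆ R) (inv-⁅x⁆-flip (x∉B ∘ proj₁ ∘ x∈p─q⁻ B R)) ⟩
    ∣ B ─ R ∣ + inv ⁅ x ⁆ R
      ∎
    where open ≡-Reasoning

  exchange-parity : ∀ {i j B R} → i ∉ B → j ∉ B → R ⊆ B →
    let m = ∣ B ─ R ∣ + (inv ⁅ i ⁆ R + inv ⁅ j ⁆ R) in
    (inv ⁅ i ⁆ B + (inv ⁅ j ⁆ B + inv (B ─ R) ⁅ j ⁆)) + (inv ⁅ i ⁆ R + inv ⁅ j ⁆ R + inv (B ─ R) ⁅ i ⁆)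
      ≡ m + m
  exchange-parity {i} {j} {B} {R} i∉B j∉B R⊆B =
    regroup (inv ⁅ i ⁆ B) (inv ⁅ j ⁆ B) (inv (B ─ R) ⁅ j ⁆) (inv (B ─ R) ⁅ i ⁆) ∣ B ─ R ∣
            (inv ⁅ i ⁆ R) (inv ⁅ j ⁆ R) (inv-⁅x⁆-⊆ i∉B R⊆B) (inv-⁅x⁆-⊆ j∉B R⊆B)
    where
    regroup : ∀ a b d e s rᵢ rⱼ → a + e ≡ s + rᵢ → b + d ≡ s + rⱼ →
      (a + (b + d)) + (rᵢ + rⱼ + e) ≡ (s + (rᵢ + rⱼ)) + (s + (rᵢ + rⱼ))
    regroup a b d e s rᵢ rⱼ a+e b+d = begin
      (a + (b + d)) + (rᵢ + rⱼ + e)      ≡⟨ pair-up a b d e (rᵢ + rⱼ) ⟩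
      (a + e) + (b + d) + (rᵢ + rⱼ)      ≡⟨ cong₂ (λ u v → u + v + (rᵢ + rⱼ)) a+e b+d ⟩
      (s + rᵢ) + (s + rⱼ) + (rᵢ + rⱼ)    ≡⟨ double s rᵢ rⱼ ⟩
      (s + (rᵢ + rⱼ)) + (s + (rᵢ + rⱼ))  ∎
      where
      open ≡-Reasoning
      pair-up : ∀ a b d e r → (a + (b + d)) + (r + e) ≡ (a + e) + (b + d) + r
      pair-up = solve-∀
      double : ∀ s rᵢ rⱼ → (s + rᵢ) + (s + rⱼ) + (rᵢ + rⱼ) ≡ (s + (rᵢ + rⱼ)) + (s + (rᵢ + rⱼ))
      double = solve-∀

module Renaming {c ℓ : Level} (F : Field c ℓ) (n : ℕ) where
  open Field F hiding (zero; _-_)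
    renaming (refl to ≈-refl; sym to ≈-sym; trans to ≈-trans; reflexive to ≈-reflexive)
  open Exterior F n
  open Inversions F n using (inv-∪ʳ; exchange-parity)
  import Data.Nat.Properties as ℕₚ
  open import Algebra.Properties.Ring ring
    using (-‿distribˡ-*; -‿distribʳ-*; -1*x≈-x; -‿involutive; -‿+-comm; +-inverseʳ-unique)
  open import Algebra.Properties.CommutativeSemigroup +-commutativeSemigroup
    using (x∙yz≈y∙xz; interchange)
  open import Algebra.Properties.CommutativeSemigroup *-commutativeSemigroup
    using () renaming (x∙yz≈y∙xz to x*yz≈y*xz)
  open import Relation.Binary.Reasoning.Setoid setoid

  sgn-+ : ∀ a b → sgn (a ℕ.+ b) ≈ sgn a * sgn b
  sgn-+ zero    b = ≈-sym (*-identityˡ (sgn b))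
  sgn-+ (suc a) b = begin
    - sgn (a ℕ.+ b)    ≈⟨ -‿cong (sgn-+ a b) ⟩
    - (sgn a * sgn b)  ≈⟨ -‿distribˡ-* (sgn a) (sgn b) ⟩
    - sgn a * sgn b    ∎

  sgn*sgn≈1 : ∀ a → sgn a * sgn a ≈ 1#
  sgn*sgn≈1 zero    = *-identityˡ 1#
  sgn*sgn≈1 (suc a) = begin
    - sgn a * - sgn a    ≈⟨ -‿distribˡ-* (sgn a) (- sgn a) ⟨
    - (sgn a * - sgn a)  ≈⟨ -‿cong (-‿distribʳ-* (sgn a) (sgn a)) ⟨
    - - (sgn a * sgn a)  ≈⟨ -‿involutive _ ⟩
    sgn a * sgn a        ≈⟨ sgn*sgn≈1 a ⟩
    1#                   ∎

  sgn-*-sgn : ∀ a b z → sgn a * (sgn b * z) ≈ sgn (a ℕ.+ b) * z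
  sgn-*-sgn a b z = begin
    sgn a * (sgn b * z)  ≈⟨ *-assoc (sgn a) (sgn b) z ⟨
    sgn a * sgn b * z    ≈⟨ *-congʳ (sgn-+ a b) ⟨
    sgn (a ℕ.+ b) * z    ∎

  sgn-cancel : ∀ a z → sgn a * (sgn a * z) ≈ z
  sgn-cancel a z = begin
    sgn a * (sgn a * z)  ≈⟨ *-assoc (sgn a) (sgn a) z ⟨
    sgn a * sgn a * z    ≈⟨ *-congʳ (sgn*sgn≈1 a) ⟩
    1# * z               ≈⟨ *-identityˡ z ⟩
    z                    ∎

  sgn-parity : ∀ a b {m} → a ℕ.+ b ≡ m ℕ.+ m → sgn a ≈ sgn b
  sgn-parity a b {m} a+b≡m+m = begin
    sgn a                    ≈⟨ sgn-cancel b (sgn a) ⟨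
    sgn b * (sgn b * sgn a)  ≈⟨ *-congˡ (*-comm (sgn b) (sgn a)) ⟩
    sgn b * (sgn a * sgn b)  ≈⟨ *-congˡ (sgn-+ a b) ⟨
    sgn b * sgn (a ℕ.+ b)    ≈⟨ *-congˡ (≈-reflexive (cong sgn a+b≡m+m)) ⟩
    sgn b * sgn (m ℕ.+ m)    ≈⟨ *-congˡ (≈-trans (sgn-+ m m) (sgn*sgn≈1 m)) ⟩
    sgn b * 1#               ≈⟨ *-identityʳ (sgn b) ⟩
    sgn b                    ∎

  x+z≈0⇒y-[x+y]≈z : ∀ {x y z} → x + z ≈ 0# → y + - 1# * (x + y) ≈ z
  x+z≈0⇒y-[x+y]≈z {x} {y} {z} x+z≈0 = begin
    y + - 1# * (x + y)  ≈⟨ +-congˡ (-1*x≈-x (x + y)) ⟩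
    y + - (x + y)       ≈⟨ +-congˡ (-‿+-comm x y) ⟨
    y + (- x + - y)     ≈⟨ x∙yz≈y∙xz y (- x) (- y) ⟩
    - x + (y + - y)     ≈⟨ +-congˡ (-‿inverseʳ y) ⟩
    - x + 0#            ≈⟨ +-identityʳ (- x) ⟩
    - x                 ≈⟨ +-inverseʳ-unique x z x+z≈0 ⟨
    z                   ∎

  if-cong : ∀ b {x x′ y y′} → x ≈ x′ → y ≈ y′ → (if b then x else y) ≈ (if b then x′ else y′)
  if-cong true  x≈x′ _    = x≈x′
  if-cong false _    y≈y′ = y≈y′

  if-+ : ∀ b {x x′ y y′} →
    (if b then x + x′ else y + y′) ≈ (if b then x else y) + (if b then x′ else y′)
  if-+ true  = ≈-refl
  if-+ false = ≈-refl

  if-* : ∀ b a {x y} → (if b then a * x else a * y) ≈ a * (if b then x else y)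
  if-* true  a = ≈-refl
  if-* false a = ≈-refl

  if-yes : ∀ {P : Set} (P? : Dec P) {x y} → P → (if does P? then x else y) ≈ x
  if-yes P? p = ≈-reflexive (cong (if_then _ else _) (dec-true P? p))

  if-no : ∀ {P : Set} (P? : Dec P) {x y} → ¬ P → (if does P? then x else y) ≈ y
  if-no P? ¬p = ≈-reflexive (cong (if_then _ else _) (dec-false P? ¬p))

  record IsLinear (f : Form → Form) : Set (c ⊔ ℓ) where
    field
      resp   : ∀ {u v} → u ≈ᵥ v → f u ≈ᵥ f v
      +-homo : ∀ u v → f (u +ᵥ v) ≈ᵥ (f u +ᵥ f v)
      ·-homo : ∀ a u → f (a ·ᵥ u) ≈ᵥ (a ·ᵥ f u)

    0-homo : ∀ {u} → u ≈ᵥ 0ᵥ → f u ≈ᵥ 0ᵥ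
    0-homo {u} u≈0 U = begin
      f u U          ≈⟨ resp (λ V → ≈-trans (u≈0 V) (≈-sym (zeroˡ (u V)))) U ⟩
      f (0# ·ᵥ u) U  ≈⟨ ·-homo 0# u U ⟩
      0# * f u U     ≈⟨ zeroˡ (f u U) ⟩
      0#             ∎

  id-linear : IsLinear id
  id-linear = record { resp = id ; +-homo = λ _ _ _ → ≈-refl ; ·-homo = λ _ _ _ → ≈-refl }

  0-linear : IsLinear (λ _ → 0ᵥ)
  0-linear = record
    { resp   = λ _ _ → ≈-refl
    ; +-homo = λ _ _ _ → ≈-sym (+-identityˡ 0#)
    ; ·-homo = λ a _ _ → ≈-sym (zeroʳ a)
    }

  scaled-reindex-linear : ∀ (a : Subset n → Carrier) (g : Subset n → Subset n) →
    IsLinear (λ u U → a U * u (g U))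
  scaled-reindex-linear a g = record
    { resp   = λ u≈v U → *-congˡ (u≈v (g U))
    ; +-homo = λ u v U → distribˡ (a U) (u (g U)) (v (g U))
    ; ·-homo = λ b u U → x*yz≈y*xz (a U) b (u (g U))
    }

  if-linear : ∀ {P : Subset n → Set} (P? : ∀ U → Dec (P U)) {f g} → IsLinear f → IsLinear g →
    IsLinear (λ u U → if does (P? U) then f u U else g u U)
  if-linear P? f-lin g-lin = record
    { resp   = λ u≈v U → if-cong (does (P? U)) (F.resp u≈v U) (G.resp u≈v U)
    ; +-homo = λ u v U → ≈-trans (if-cong (does (P? U)) (F.+-homo u v U) (G.+-homo u v U))
                                 (if-+ (does (P? U)))
    ; ·-homo = λ a u U → ≈-trans (if-cong (does (P? U)) (F.·-homo a u U) (G.·-homo a u U))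
                                 (if-* (does (P? U)) a)
    }
    where
    module F = IsLinear f-lin
    module G = IsLinear g-lin

  +-linear : ∀ {f g} → IsLinear f → IsLinear g → IsLinear (λ u → f u +ᵥ g u)
  +-linear f-lin g-lin = record
    { resp   = λ u≈v U → +-cong (F.resp u≈v U) (G.resp u≈v U)
    ; +-homo = λ u v U → ≈-trans (+-cong (F.+-homo u v U) (G.+-homo u v U)) (interchange _ _ _ _)
    ; ·-homo = λ a u U → ≈-trans (+-cong (F.·-homo a u U) (G.·-homo a u U)) (≈-sym (distribˡ a _ _))
    }
    where
    module F = IsLinear f-lin
    module G = IsLinear g-lin

  ∘-linear : ∀ {f g} → IsLinear f → IsLinear g → IsLinear (f ∘ g)
  ∘-linear {f} {g} f-lin g-lin = record
    { resp   = F.resp ∘ G.resp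
    ; +-homo = λ u v U → ≈-trans (F.resp (G.+-homo u v) U) (F.+-homo (g u) (g v) U)
    ; ·-homo = λ a u U → ≈-trans (F.resp (G.·-homo a u) U) (F.·-homo a (g u) U)
    }
    where
    module F = IsLinear f-lin
    module G = IsLinear g-lin

  ₘ∧-linear : ∀ T → IsLinear (T ₘ∧_)
  ₘ∧-linear T = if-linear (T ⊆?_) (scaled-reindex-linear (λ U → sgn (inv T (U ─ T))) (_─ T)) 0-linear

  ₘ∧-⊈ : ∀ {T U} y → ¬ T ⊆ U → (T ₘ∧ y) U ≈ 0#
  ₘ∧-⊈ {T} {U} y T⊈U = if-no (T ⊆? U) T⊈U

  ∧ₘ-⊈ : ∀ {T U} u → ¬ T ⊆ U → (u ∧ₘ T) U ≈ 0#
  ∧ₘ-⊈ {T} {U} u T⊈U = if-no (T ⊆? U) T⊈U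

  ⁅x⁆ₘ∧-at-∪⁅x⁆ : ∀ {x B} y → x ∉ B → (⁅ x ⁆ ₘ∧ y) (B ∪ ⁅ x ⁆) ≈ sgn (inv ⁅ x ⁆ B) * y B
  ⁅x⁆ₘ∧-at-∪⁅x⁆ {x} {B} y x∉B = begin
    (⁅ x ⁆ ₘ∧ y) (B ∪ ⁅ x ⁆)
      ≈⟨ if-yes (⁅ x ⁆ ⊆? B ∪ ⁅ x ⁆) (q⊆p∪q B ⁅ x ⁆) ⟩
    sgn (inv ⁅ x ⁆ ((B ∪ ⁅ x ⁆) - x)) * y ((B ∪ ⁅ x ⁆) - x)
      ≡⟨ cong (λ A → sgn (inv ⁅ x ⁆ A) * y A) (p∪⁅x⁆-x≡p x∉B) ⟩
    sgn (inv ⁅ x ⁆ B) * y B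
      ∎

  ∧ₘ∪⁅x⁆-at-∪⁅x⁆ : ∀ {x B R} u → x ∉ B → x ∉ R →
    (u ∧ₘ (R ∪ ⁅ x ⁆)) (B ∪ ⁅ x ⁆) ≈ sgn (inv (B ─ R) ⁅ x ⁆) * (u ∧ₘ R) B
  ∧ₘ∪⁅x⁆-at-∪⁅x⁆ {x} {B} {R} u x∉B x∉R = by-cases (R ⊆? B)
    where
    R∩⁅x⁆=∅ : ∀ {y} → y ∈ R → y ∉ ⁅ x ⁆
    R∩⁅x⁆=∅ y∈R y∈⁅x⁆ = x∉R (subst (_∈ R) (x∈⁅y⁆⇒x≡y x y∈⁅x⁆) y∈R)
    by-cases : Dec (R ⊆ B) → (u ∧ₘ (R ∪ ⁅ x ⁆)) (B ∪ ⁅ x ⁆) ≈ sgn (inv (B ─ R) ⁅ x ⁆) * (u ∧ₘ R) B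
    by-cases (no R⊈B) = begin
      (u ∧ₘ (R ∪ ⁅ x ⁆)) (B ∪ ⁅ x ⁆)         ≈⟨ ∧ₘ-⊈ u (R⊈B ∘ ∪⁅x⁆-cancelˡ-⊆ x∉R) ⟩
      0#                                    ≈⟨ zeroʳ _ ⟨
      sgn (inv (B ─ R) ⁅ x ⁆) * 0#          ≈⟨ *-congˡ (∧ₘ-⊈ u R⊈B) ⟨
      sgn (inv (B ─ R) ⁅ x ⁆) * (u ∧ₘ R) B  ∎
    by-cases (yes R⊆B) = begin
      (u ∧ₘ (R ∪ ⁅ x ⁆)) (B ∪ ⁅ x ⁆)
        ≈⟨ if-yes (R ∪ ⁅ x ⁆ ⊆? B ∪ ⁅ x ⁆) (∪-monoˡ-⊆ ⁅ x ⁆ R⊆B) ⟩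
      sgn (inv ((B ∪ ⁅ x ⁆) ─ (R ∪ ⁅ x ⁆)) (R ∪ ⁅ x ⁆)) * u ((B ∪ ⁅ x ⁆) ─ (R ∪ ⁅ x ⁆))
        ≡⟨ cong (λ A → sgn (inv A (R ∪ ⁅ x ⁆)) * u A) (p∪⁅x⁆─q∪⁅x⁆≡p─q R x∉B) ⟩
      sgn (inv (B ─ R) (R ∪ ⁅ x ⁆)) * u (B ─ R)
        ≡⟨ cong (λ k → sgn k * u (B ─ R)) (trans (inv-∪ʳ (B ─ R) R∩⁅x⁆=∅) (ℕₚ.+-comm (inv (B ─ R) R) _)) ⟩
      sgn (inv (B ─ R) ⁅ x ⁆ ℕ.+ inv (B ─ R) R) * u (B ─ R)
        ≈⟨ sgn-*-sgn (inv (B ─ R) ⁅ x ⁆) (inv (B ─ R) R) (u (B ─ R)) ⟨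
      sgn (inv (B ─ R) ⁅ x ⁆) * (sgn (inv (B ─ R) R) * u (B ─ R))
        ≈⟨ *-congˡ (if-yes (R ⊆? B) R⊆B) ⟨
      sgn (inv (B ─ R) ⁅ x ⁆) * (u ∧ₘ R) B
        ∎

  InWedge-⊆ : ∀ {J K u} → J ⊆ K → InWedge K u → InWedge J u
  InWedge-⊆ J⊆K u∌K S h h∈S h∈J = u∌K S h h∈S (J⊆K h∈J)

  InWedge-resp : ∀ {J u v} → u ≈ᵥ v → InWedge J u → InWedge J v
  InWedge-resp u≈v u∌J S h h∈S h∈J = ≈-trans (≈-sym (u≈v S)) (u∌J S h h∈S h∈J)

  InWedge-+ᵥ : ∀ {J u v} → InWedge J u → InWedge J v → InWedge J (u +ᵥ v)
  InWedge-+ᵥ u∌J v∌J S h h∈S h∈J = ≈-trans (+-cong (u∌J S h h∈S h∈J) (v∌J S h h∈S h∈J)) (+-identityʳ 0#)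

  InWedge-ₘ∧ : ∀ {J T y} → (∀ {h} → h ∈ J → h ∉ T) → InWedge J y → InWedge J (T ₘ∧ y)
  InWedge-ₘ∧ {J} {T} {y} J∩T=∅ y∌J S h h∈S h∈J with T ⊆? S
  ... | no  _ = ≈-refl
  ... | yes _ = ≈-trans (*-congˡ (y∌J (S ─ T) h (x∈p∧x∉q⇒x∈p─q h∈S (J∩T=∅ h∈J)) h∈J)) (zeroʳ _)

  InWedge-∧ₘ : ∀ {J T u} → (∀ {h} → h ∈ J → h ∉ T) → InWedge J u → InWedge J (u ∧ₘ T)
  InWedge-∧ₘ {J} {T} {u} J∩T=∅ u∌J S h h∈S h∈J with T ⊆? S
  ... | no  _ = ≈-refl
  ... | yes _ = ≈-trans (*-congˡ (u∌J (S ─ T) h (x∈p∧x∉q⇒x∈p─q h∈S (J∩T=∅ h∈J)) h∈J)) (zeroʳ _)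

  avoid : Fin n → Form → Form
  avoid j u U = if does (j ∈? U) then 0# else u U

  contract : Fin n → Form → Form
  contract j u U = if does (j ∈? U) then 0# else sgn (inv ⁅ j ⁆ U) * u (U ∪ ⁅ j ⁆)

  rename : Fin n → Fin n → Form → Form
  rename j i u = avoid j u +ᵥ (⁅ i ⁆ ₘ∧ contract j u)

  rename-linear : ∀ j i → IsLinear (rename j i)
  rename-linear j i = +-linear avoid-linear (∘-linear (ₘ∧-linear ⁅ i ⁆) contract-linear)
    where
    avoid-linear : IsLinear (avoid j)
    avoid-linear = if-linear (j ∈?_) 0-linear id-linear
    contract-linear : IsLinear (contract j)
    contract-linear =
      if-linear (j ∈?_) 0-linear (scaled-reindex-linear (λ U → sgn (inv ⁅ j ⁆ U)) (_∪ ⁅ j ⁆))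

  contract-∈ : ∀ {j U} u → j ∈ U → contract j u U ≈ 0#
  contract-∈ {j} {U} u j∈U = if-yes (j ∈? U) j∈U

  contract-∉ : ∀ {j U} u → j ∉ U → contract j u U ≈ sgn (inv ⁅ j ⁆ U) * u (U ∪ ⁅ j ⁆)
  contract-∉ {j} {U} u j∉U = if-no (j ∈? U) j∉U

  avoid-decomp : ∀ {j X} Y → InWedge ⁅ j ⁆ X → avoid j (X +ᵥ (⁅ j ⁆ ₘ∧ Y)) ≈ᵥ X
  avoid-decomp {j} {X} Y X∌j U with j ∈? U
  ... | yes j∈U = ≈-sym (X∌j U j j∈U (x∈⁅x⁆ j))
  ... | no  j∉U = begin
    X U + (⁅ j ⁆ ₘ∧ Y) U  ≈⟨ +-congˡ (ₘ∧-⊈ Y (λ ⁅j⁆⊆U → j∉U (⁅j⁆⊆U (x∈⁅x⁆ j)))) ⟩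
    X U + 0#             ≈⟨ +-identityʳ (X U) ⟩
    X U                  ∎

  contract-decomp : ∀ {j X Y} → InWedge ⁅ j ⁆ X → InWedge ⁅ j ⁆ Y →
    contract j (X +ᵥ (⁅ j ⁆ ₘ∧ Y)) ≈ᵥ Y
  contract-decomp {j} {X} {Y} X∌j Y∌j U with j ∈? U
  ... | yes j∈U = ≈-sym (Y∌j U j j∈U (x∈⁅x⁆ j))
  ... | no  j∉U = begin
    s * (X (U ∪ ⁅ j ⁆) + (⁅ j ⁆ ₘ∧ Y) (U ∪ ⁅ j ⁆))
      ≈⟨ *-congˡ (+-cong (X∌j _ j (q⊆p∪q U ⁅ j ⁆ (x∈⁅x⁆ j)) (x∈⁅x⁆ j)) (⁅x⁆ₘ∧-at-∪⁅x⁆ Y j∉U)) ⟩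
    s * (0# + s * Y U)  ≈⟨ *-congˡ (+-identityˡ _) ⟩
    s * (s * Y U)       ≈⟨ sgn-cancel (inv ⁅ j ⁆ U) (Y U) ⟩
    Y U                 ∎
    where
    s : Carrier
    s = sgn (inv ⁅ j ⁆ U)

  rename-decomp : ∀ {j i X Y} → InWedge ⁅ j ⁆ X → InWedge ⁅ j ⁆ Y →
    rename j i (X +ᵥ (⁅ j ⁆ ₘ∧ Y)) ≈ᵥ (X +ᵥ (⁅ i ⁆ ₘ∧ Y))
  rename-decomp {i = i} {Y = Y} X∌j Y∌j U =
    +-cong (avoid-decomp Y X∌j U) (IsLinear.resp (ₘ∧-linear ⁅ i ⁆) (contract-decomp X∌j Y∌j) U)

  rename-InWedge : ∀ {j i u} → InWedge ⁅ j ⁆ u → rename j i u ≈ᵥ u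
  rename-InWedge {j} {i} {u} u∌j U = begin
    avoid j u U + (⁅ i ⁆ ₘ∧ contract j u) U
      ≈⟨ +-cong (avoid≈id U) (IsLinear.0-homo (ₘ∧-linear ⁅ i ⁆) contract≈0 U) ⟩
    u U + 0#
      ≈⟨ +-identityʳ (u U) ⟩
    u U
      ∎
    where
    avoid≈id : avoid j u ≈ᵥ u
    avoid≈id U with j ∈? U
    ... | yes j∈U = ≈-sym (u∌j U j j∈U (x∈⁅x⁆ j))
    ... | no  _   = ≈-refl
    contract≈0 : contract j u ≈ᵥ 0ᵥ
    contract≈0 U with j ∈? U
    ... | yes _ = ≈-refl
    ... | no  _ = ≈-trans (*-congˡ (u∌j _ j (q⊆p∪q U ⁅ j ⁆ (x∈⁅x⁆ j)) (x∈⁅x⁆ j))) (zeroʳ _)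

  avoid-∧ₘ : ∀ {j T} u → j ∈ T → avoid j (u ∧ₘ T) ≈ᵥ 0ᵥ
  avoid-∧ₘ {j} {T} u j∈T U with j ∈? U
  ... | yes _   = ≈-refl
  ... | no  j∉U = ∧ₘ-⊈ u (λ T⊆U → j∉U (T⊆U j∈T))

  -- The coefficients at B ∪ i of e_i ∧ contract j (u ∧ e_{R ∪ j}) and of ± u ∧ e_{R ∪ i}.
  exchange-sign : ∀ {i j B R} u → i ∉ B → j ∉ B →
    sgn (inv ⁅ i ⁆ B) * (sgn (inv ⁅ j ⁆ B) * (sgn (inv (B ─ R) ⁅ j ⁆) * (u ∧ₘ R) B))
      ≈ sgn (inv ⁅ i ⁆ R ℕ.+ inv ⁅ j ⁆ R) * (sgn (inv (B ─ R) ⁅ i ⁆) * (u ∧ₘ R) B)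
  exchange-sign {i} {j} {B} {R} u i∉B j∉B = begin
    sgn bᵢ * (sgn bⱼ * (sgn dⱼ * z))  ≈⟨ *-congˡ (sgn-*-sgn bⱼ dⱼ z) ⟩
    sgn bᵢ * (sgn (bⱼ ℕ.+ dⱼ) * z)    ≈⟨ sgn-*-sgn bᵢ (bⱼ ℕ.+ dⱼ) z ⟩
    sgn (bᵢ ℕ.+ (bⱼ ℕ.+ dⱼ)) * z      ≈⟨ by-parity (R ⊆? B) ⟩
    sgn (r ℕ.+ dᵢ) * z                ≈⟨ sgn-*-sgn r dᵢ z ⟨
    sgn r * (sgn dᵢ * z)              ∎
    where
    bᵢ bⱼ dᵢ dⱼ r : ℕ
    bᵢ = inv ⁅ i ⁆ B
    bⱼ = inv ⁅ j ⁆ B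
    dᵢ = inv (B ─ R) ⁅ i ⁆
    dⱼ = inv (B ─ R) ⁅ j ⁆
    r  = inv ⁅ i ⁆ R ℕ.+ inv ⁅ j ⁆ R
    z : Carrier
    z = (u ∧ₘ R) B
    by-parity : Dec (R ⊆ B) → sgn (bᵢ ℕ.+ (bⱼ ℕ.+ dⱼ)) * z ≈ sgn (r ℕ.+ dᵢ) * z
    by-parity (yes R⊆B) =
      *-congʳ (sgn-parity (bᵢ ℕ.+ (bⱼ ℕ.+ dⱼ)) (r ℕ.+ dᵢ) {∣ B ─ R ∣ ℕ.+ r} (exchange-parity i∉B j∉B R⊆B))
    by-parity (no  R⊈B) = begin
      sgn (bᵢ ℕ.+ (bⱼ ℕ.+ dⱼ)) * z   ≈⟨ *-congˡ (∧ₘ-⊈ u R⊈B) ⟩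
      sgn (bᵢ ℕ.+ (bⱼ ℕ.+ dⱼ)) * 0#  ≈⟨ zeroʳ _ ⟩
      0#                            ≈⟨ zeroʳ _ ⟨
      sgn (r ℕ.+ dᵢ) * 0#           ≈⟨ *-congˡ (∧ₘ-⊈ u R⊈B) ⟨
      sgn (r ℕ.+ dᵢ) * z            ∎

  exchange-coefficient : ∀ {i j B R} u → InWedge ⁅ j ⁆ u → i ∉ B → j ∉ R →
    sgn (inv ⁅ i ⁆ B) * contract j (u ∧ₘ (R ∪ ⁅ j ⁆)) B
      ≈ sgn (inv ⁅ i ⁆ R ℕ.+ inv ⁅ j ⁆ R) * (sgn (inv (B ─ R) ⁅ i ⁆) * (u ∧ₘ R) B)
  exchange-coefficient {i} {j} {B} {R} u u∌j i∉B j∉R = by-cases (j ∈? B)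
    where
    w : Form
    w = u ∧ₘ (R ∪ ⁅ j ⁆)
    r : ℕ
    r = inv ⁅ i ⁆ R ℕ.+ inv ⁅ j ⁆ R
    by-cases : Dec (j ∈ B) →
      sgn (inv ⁅ i ⁆ B) * contract j w B ≈ sgn r * (sgn (inv (B ─ R) ⁅ i ⁆) * (u ∧ₘ R) B)
    by-cases (no j∉B) = begin
      sgn (inv ⁅ i ⁆ B) * contract j w B
        ≈⟨ *-congˡ (contract-∉ w j∉B) ⟩
      sgn (inv ⁅ i ⁆ B) * (sgn (inv ⁅ j ⁆ B) * w (B ∪ ⁅ j ⁆))
        ≈⟨ *-congˡ (*-congˡ (∧ₘ∪⁅x⁆-at-∪⁅x⁆ u j∉B j∉R)) ⟩
      sgn (inv ⁅ i ⁆ B) * (sgn (inv ⁅ j ⁆ B) * (sgn (inv (B ─ R) ⁅ j ⁆) * (u ∧ₘ R) B))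
        ≈⟨ exchange-sign u i∉B j∉B ⟩
      sgn r * (sgn (inv (B ─ R) ⁅ i ⁆) * (u ∧ₘ R) B)
        ∎
    by-cases (yes j∈B) = begin
      sgn (inv ⁅ i ⁆ B) * contract j w B              ≈⟨ *-congˡ (contract-∈ w j∈B) ⟩
      sgn (inv ⁅ i ⁆ B) * 0#                          ≈⟨ zeroʳ _ ⟩
      0#                                              ≈⟨ zeroʳ _ ⟨
      sgn r * 0#                                      ≈⟨ *-congˡ (zeroʳ _) ⟨
      sgn r * (sgn (inv (B ─ R) ⁅ i ⁆) * 0#)           ≈⟨ *-congˡ (*-congˡ uR[B]≈0) ⟨
      sgn r * (sgn (inv (B ─ R) ⁅ i ⁆) * (u ∧ₘ R) B)   ∎
      where
      uR[B]≈0 : (u ∧ₘ R) B ≈ 0#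
      uR[B]≈0 = InWedge-∧ₘ (λ h∈⁅j⁆ → j∉R ∘ subst (_∈ R) (x∈⁅y⁆⇒x≡y j h∈⁅j⁆)) u∌j B j j∈B (x∈⁅x⁆ j)

  rename-∧ₘ : ∀ {i j R u} → InWedge ⁅ j ⁆ u → i ∉ R → j ∉ R →
    rename j i (u ∧ₘ (R ∪ ⁅ j ⁆)) ≈ᵥ (sgn (inv ⁅ i ⁆ R ℕ.+ inv ⁅ j ⁆ R) ·ᵥ (u ∧ₘ (R ∪ ⁅ i ⁆)))
  rename-∧ₘ {i} {j} {R} {u} u∌j i∉R j∉R U = begin
    avoid j w U + (⁅ i ⁆ ₘ∧ contract j w) U  ≈⟨ +-congʳ (avoid-∧ₘ u (q⊆p∪q R ⁅ j ⁆ (x∈⁅x⁆ j)) U) ⟩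
    0# + (⁅ i ⁆ ₘ∧ contract j w) U           ≈⟨ +-identityˡ _ ⟩
    (⁅ i ⁆ ₘ∧ contract j w) U                ≈⟨ at U (i ∈? U) ⟩
    sgn r * (u ∧ₘ (R ∪ ⁅ i ⁆)) U             ∎
    where
    w : Form
    w = u ∧ₘ (R ∪ ⁅ j ⁆)
    r : ℕ
    r = inv ⁅ i ⁆ R ℕ.+ inv ⁅ j ⁆ R
    at-∪⁅i⁆ : ∀ B → i ∉ B →
      (⁅ i ⁆ ₘ∧ contract j w) (B ∪ ⁅ i ⁆) ≈ sgn r * (u ∧ₘ (R ∪ ⁅ i ⁆)) (B ∪ ⁅ i ⁆)
    at-∪⁅i⁆ B i∉B = begin
      (⁅ i ⁆ ₘ∧ contract j w) (B ∪ ⁅ i ⁆)             ≈⟨ ⁅x⁆ₘ∧-at-∪⁅x⁆ (contract j w) i∉B ⟩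
      sgn (inv ⁅ i ⁆ B) * contract j w B               ≈⟨ exchange-coefficient u u∌j i∉B j∉R ⟩
      sgn r * (sgn (inv (B ─ R) ⁅ i ⁆) * (u ∧ₘ R) B)   ≈⟨ *-congˡ (∧ₘ∪⁅x⁆-at-∪⁅x⁆ u i∉B i∉R) ⟨
      sgn r * (u ∧ₘ (R ∪ ⁅ i ⁆)) (B ∪ ⁅ i ⁆)            ∎
    at : ∀ U → Dec (i ∈ U) → (⁅ i ⁆ ₘ∧ contract j w) U ≈ sgn r * (u ∧ₘ (R ∪ ⁅ i ⁆)) U
    at U (yes i∈U) = subst (λ V → (⁅ i ⁆ ₘ∧ contract j w) V ≈ sgn r * (u ∧ₘ (R ∪ ⁅ i ⁆)) V)
                           (p-x∪⁅x⁆≡p i∈U) (at-∪⁅i⁆ (U - i) (x∉p-x U i))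
    at U (no i∉U)  = begin
      (⁅ i ⁆ ₘ∧ contract j w) U     ≈⟨ ₘ∧-⊈ (contract j w) (λ ⁅i⁆⊆U → i∉U (⁅i⁆⊆U (x∈⁅x⁆ i))) ⟩
      0#                           ≈⟨ zeroʳ _ ⟨
      sgn r * 0#                   ≈⟨ *-congˡ (∧ₘ-⊈ u (λ R∪i⊆U → i∉U (R∪i⊆U (q⊆p∪q R ⁅ i ⁆ (x∈⁅x⁆ i))))) ⟨
      sgn r * (u ∧ₘ (R ∪ ⁅ i ⁆)) U  ∎

  module _ {k p} (L : Subspace k p) where
    open Subspace L

    linear-image-Span : ∀ {q} {Q : Form → Set q} {f} → IsLinear f →
      (∀ {v} → Q v → Mem (f v)) → ∀ {v} → Span Q v → Mem (f v)
    linear-image-Span f-lin Q⇒ (gen Qv)   = Q⇒ Qv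
    linear-image-Span f-lin Q⇒ (zer v≈0)  = resp (λ U → ≈-sym (IsLinear.0-homo f-lin v≈0 U)) zero-mem
    linear-image-Span f-lin Q⇒ (add {a} {b} Sa Sb v≈a+b) =
      resp (λ U → ≈-sym (≈-trans (F.resp v≈a+b U) (F.+-homo a b U)))
           (add-mem (linear-image-Span f-lin Q⇒ Sa) (linear-image-Span f-lin Q⇒ Sb))
      where module F = IsLinear f-lin
    linear-image-Span f-lin Q⇒ (scal {a} r Sa v≈ra) =
      resp (λ U → ≈-sym (≈-trans (F.resp v≈ra U) (F.·-homo r a U)))
           (scal-mem r (linear-image-Span f-lin Q⇒ Sa))
      where module F = IsLinear f-lin

    rename-N-image : ∀ {j i m m′} → i ≢ j → Mem m → NRel j i m m′ → Mem m′ → Mem (rename j i m′)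
    rename-N-image {j} {i} {m′ = m′} i≢j _ (X , Y , X∌j , Y∌j , _ , inj₁ (_ , m′≈X+eiY)) m′∈L =
      resp (λ U → ≈-sym (rename-InWedge m′∌j U)) m′∈L
      where
      ⁅j⁆∩⁅i⁆=∅ : ∀ {h} → h ∈ ⁅ j ⁆ → h ∉ ⁅ i ⁆
      ⁅j⁆∩⁅i⁆=∅ h∈⁅j⁆ h∈⁅i⁆ = i≢j (trans (sym (x∈⁅y⁆⇒x≡y i h∈⁅i⁆)) (x∈⁅y⁆⇒x≡y j h∈⁅j⁆))
      m′∌j : InWedge ⁅ j ⁆ m′
      m′∌j = InWedge-resp (λ U → ≈-sym (m′≈X+eiY U)) (InWedge-+ᵥ X∌j (InWedge-ₘ∧ ⁅j⁆∩⁅i⁆=∅ Y∌j))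
    rename-N-image {j} {i} {m} {m′} _ m∈L (X , Y , _ , Y∌j , m≈X+ejY , inj₂ (X+eiY≈0 , m′≈ejY)) m′∈L =
      resp m′-m≈rename (add-mem m′∈L (scal-mem (- 1#) m∈L))
      where
      m′≈0+ejY : m′ ≈ᵥ (0ᵥ +ᵥ (⁅ j ⁆ ₘ∧ Y))
      m′≈0+ejY U = ≈-trans (m′≈ejY U) (≈-sym (+-identityˡ _))
      m′-m≈rename : (m′ +ᵥ ((- 1#) ·ᵥ m)) ≈ᵥ rename j i m′
      m′-m≈rename U = begin
        m′ U + - 1# * m U                               ≈⟨ +-cong (m′≈ejY U) (*-congˡ (m≈X+ejY U)) ⟩
        (⁅ j ⁆ ₘ∧ Y) U + - 1# * (X U + (⁅ j ⁆ ₘ∧ Y) U)  ≈⟨ x+z≈0⇒y-[x+y]≈z (X+eiY≈0 U) ⟩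
        (⁅ i ⁆ ₘ∧ Y) U                                  ≈⟨ +-identityˡ _ ⟨
        0# + (⁅ i ⁆ ₘ∧ Y) U                             ≈⟨ rename-decomp (λ _ _ _ _ → ≈-refl) Y∌j U ⟨
        rename j i (0ᵥ +ᵥ (⁅ j ⁆ ₘ∧ Y)) U               ≈⟨ IsLinear.resp (rename-linear j i) m′≈0+ejY U ⟨
        rename j i m′ U                                 ∎

    rename-closed : ∀ {j i u} → i ≢ j → NFixes j i L → Mem u → Mem (rename j i u)
    rename-closed {j} {i} {u} i≢j N[L]≡L u∈L =
      linear-image-Span (rename-linear j i) N-image (proj₂ (N[L]≡L u) u∈L)
      where
      N-image : ∀ {v} → Σ[ m ∈ Form ] Mem m × ¬ (m ≈ᵥ 0ᵥ) × NRel j i m v → Mem (rename j i v)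
      N-image Nv@(_ , m∈L , _ , m↦v) = rename-N-image i≢j m∈L m↦v (proj₁ (N[L]≡L _) (gen Nv))

    ∧ₘ-exchange-closed : ∀ {i j T u} → i ≢ j → NFixes j i L → InWedge ⁅ j ⁆ u → j ∈ T → i ∉ T →
      Mem (u ∧ₘ T) → Mem (u ∧ₘ ((T - j) ∪ ⁅ i ⁆))
    ∧ₘ-exchange-closed {i} {j} {T} {u} i≢j N[L]≡L u∌j j∈T i∉T uT∈L =
      resp unscale (scal-mem (sgn r) (rename-closed i≢j N[L]≡L uR∪j∈L))
      where
      R : Subset n
      R = T - j
      r : ℕ
      r = inv ⁅ i ⁆ R ℕ.+ inv ⁅ j ⁆ R
      uR∪j∈L : Mem (u ∧ₘ (R ∪ ⁅ j ⁆))
      uR∪j∈L = subst (λ A → Mem (u ∧ₘ A)) (sym (p-x∪⁅x⁆≡p j∈T)) uT∈L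
      unscale : (sgn r ·ᵥ rename j i (u ∧ₘ (R ∪ ⁅ j ⁆))) ≈ᵥ (u ∧ₘ (R ∪ ⁅ i ⁆))
      unscale U = ≈-trans (*-congˡ (rename-∧ₘ u∌j (i∉T ∘ p─q⊆p T ⁅ j ⁆) (x∉p-x T j) U))
                          (sgn-cancel r ((u ∧ₘ (R ∪ ⁅ i ⁆)) U))

exchange-closed⇒shifted : ∀ {q} (𝓕 : Subset n → Set q) I →
  (∀ i j → i ∈ I → j ∈ I → i < j → ∀ T → 𝓕 T → j ∈ T → i ∉ T → 𝓕 ((T - j) ∪ ⁅ i ⁆)) →
  Shifting.ShiftedWrt 𝓕 I
exchange-closed⇒shifted 𝓕 I closed i j i∈I j∈I i<j G = shift⊆𝓕 , 𝓕⊆shift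
  where
  open Shifting 𝓕
  exchanged : ∀ T → 𝓕 T → j ∈ T → i ∉ T → 𝓕 ((T - j) ∪ ⁅ i ⁆)
  exchanged = closed i j i∈I j∈I i<j
  shift⊆𝓕 : shiftFam j i G → 𝓕 G
  shift⊆𝓕 (T , 𝓕T , inj₁ (j∈T , i∉T , ¬𝓕T′ , _)) = contradiction (exchanged T 𝓕T j∈T i∉T) ¬𝓕T′
  shift⊆𝓕 (T , 𝓕T , inj₂ (_ , G≡T))               = subst 𝓕 (sym G≡T) 𝓕T
  𝓕⊆shift : 𝓕 G → shiftFam j i G
  𝓕⊆shift 𝓕G = G , 𝓕G , inj₂ ((λ (j∈G , i∉G , ¬𝓕G′) → ¬𝓕G′ (exchanged G 𝓕G j∈G i∉G)) , refl)

proposition3p12 : ∀ {c ℓ p : Level} (F : Field c ℓ) →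
    ¬ (Field._≈_ F (Field._+_ F (Field.1# F) (Field.1# F)) (Field.0# F)) →
    (n k : ℕ) (L : Exterior.Subspace F n k p) (I : Subset n) →
    (∀ i j → i ∈ I → j ∈ I → i < j → Exterior.NFixes F n j i L) →
    (x : Exterior.Form F n) → Exterior.InWedge F n I x →
    Shifting.ShiftedWrt
    (λ T → T ⊆ I × Exterior.Subspace.Mem L (Exterior._∧ₘ_ F n x T)) I
proposition3p12 F _ n k L I N[L]≡L x x∌I = exchange-closed⇒shifted _ I exchange
  where
  open Exterior F n using (_∧ₘ_)
  open Exterior.Subspace L using (Mem)
  open Renaming F n using (InWedge-⊆; ∧ₘ-exchange-closed)
  exchange : ∀ i j → i ∈ I → j ∈ I → i < j → ∀ T → T ⊆ I × Mem (x ∧ₘ T) → j ∈ T → i ∉ T →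
    (T - j) ∪ ⁅ i ⁆ ⊆ I × Mem (x ∧ₘ ((T - j) ∪ ⁅ i ⁆))
  exchange i j i∈I j∈I i<j T (T⊆I , xT∈L) j∈T i∉T =
      ∪-lub (⊆-trans (p─q⊆p T ⁅ j ⁆) T⊆I) (x∈p⇒⁅x⁆⊆p i∈I)
    , ∧ₘ-exchange-closed L (<⇒≢ i<j) (N[L]≡L i j i∈I j∈I i<j) x∌j j∈T i∉T xT∈L
    where
    x∌j : Exterior.InWedge F n ⁅ j ⁆ x
    x∌j = InWedge-⊆ (x∈p⇒⁅x⁆⊆p j∈I) x∌I
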